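{- For all integers $j\geq1$ and $k\geq1$, \[ \pi_5(b(j,k))\geq j+\left\lfloor\frac{5k-5}{2}\right\rfloor. \]
   Context: $\pi_5(n)$ denotes the exponent of the highest power of $5$ dividing $n$, with $\pi_5(0)=+\infty$. The integers $m(i,j)$ ($i,j\geq1$) are defined by: $m(1,1)=5$, $m(2,1)=10$, $m(3,1)=9$, $m(4,1)=4$, $m(5,1)=1$, $m(i,1)=0$ for $i\geq6$; and for $j\geq2$, $i\geq1$, $m(i,j)=25m(i-1,j-1)+25m(i-2,j-1)+15m(i-3,j-1)+5m(i-4,j-1)+m(i-5,j-1)$, with $m(i',j')=0$ whenever $i'\leq0$. The integers $b(j,k)$ are defined by $b(1,1)=315$, $b(1,2)=52\cdot5^4$, $b(1,3)=63\cdot5^6$, $b(1,4)=6\cdot5^9$, $b(1,5)=5^{11}$, $b(1,k)=0$ for $k\geq6$, and $b(j+1,k)=\sum_{i\geq1}b(j,i)m(6i+6,k+i+1)$ for $j,k\geq1$. -}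

module Defs where

open import Data.Nat using (ℕ; zero; suc; _+_; _*_; _∸_; _^_; _/_)
open import Data.List using (List; map)
open import Data.Nat.ListAction using (sum)
open import Data.List using (upTo)

-- m(i,j) with i, j ≥ 1; value 0 whenever i ≤ 0 (index 0 here).
-- Indices are the paper's indices directly (index 0 means "i ≤ 0").
m : ℕ → ℕ → ℕ
m _ zero = 0
m 1 1 = 5
m 2 1 = 10
m 3 1 = 9
m 4 1 = 4
m 5 1 = 1
m _ 1 = 0
m zero (suc (suc j)) = 0
m (suc i) (suc (suc j)) =
  25 * m i (suc j) + 25 * m (i ∸ 1) (suc j) + 15 * m (i ∸ 2) (suc j)
  + 5 * m (i ∸ 3) (suc j) + m (i ∸ 4) (suc j)
  -- here the paper's i is (suc i); m(i-1,..) = m i .., etc.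
  -- Truncated subtraction maps negative indices to 0, where m is 0.

sumFrom1 : ℕ → (ℕ → ℕ) → ℕ
sumFrom1 n f = sum (map (λ i → f (suc i)) (upTo n))

b : ℕ → ℕ → ℕ
b _ zero = 0
b zero _ = 0
b 1 1 = 315
b 1 2 = 52 * 5 ^ 4
b 1 3 = 63 * 5 ^ 6
b 1 4 = 6 * 5 ^ 9
b 1 5 = 5 ^ 11
b 1 _ = 0
b (suc (suc j)) (suc k) =
  sumFrom1 (5 * suc k) (λ i → b (suc j) i * m (6 * i + 6) (suc k + i + 1))

-- The recurrence for m has coefficients 25, 25, 15, 5, 1 = 5^a·c at shifts
-- t = 0, …, 4 with 2a + t ≥ 4 in every case, so by induction on j,
-- 5^e ∣ m(i,j) whenever 2e + i < 5j.  For b, induct on j: in the summand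
-- b(j,i)·m(6i+6,k+i+1) it suffices to take the (weak) factor 5^(j+2(i−1))
-- from b(j,i) and the rest of the required power from m; the inequality
-- 2e ≤ 5(k−1) avoids floors until the very end.
module Submission where

open import Defs
open import Data.Nat using (ℕ; _+_; _*_; _∸_; _^_; _/_; _≥_)
open import Data.Nat.Divisibility using (_∣_)

open import Data.Nat using (zero; suc; _≤_; _<_; z≤n; s≤s; _≤?_)
open import Data.Nat.Properties
open import Data.Nat.Divisibility
  using (divides; ∣-trans; ∣-refl; _∣0; 1∣_; m∣m*n; ∣n⇒∣m*n; *-pres-∣; ∣m∣n⇒∣m+n)
open import Data.Nat.DivMod using (m/n*n≤m; m*n/n≡m; /-monoˡ-≤)
open import Data.Nat.ListAction using (sum)
open import Data.List using ([]; _∷_; map; upTo)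
open import Data.Empty using (⊥-elim)
open import Function using (_$_)
open import Relation.Nullary using (yes; no)
open import Relation.Binary.PropositionalEquality
open import Data.Nat.Tactic.RingSolver using (solve-∀)

^-monoʳ-∣ : ∀ p {a b} → a ≤ b → p ^ a ∣ p ^ b
^-monoʳ-∣ p {a} {b} a≤b =
  subst (p ^ a ∣_) p^a*p^[b∸a]≡p^b (m∣m*n (p ^ (b ∸ a)))
  where
  p^a*p^[b∸a]≡p^b : p ^ a * p ^ (b ∸ a) ≡ p ^ b
  p^a*p^[b∸a]≡p^b =
    trans (sym (^-distribˡ-+-* p a (b ∸ a))) (cong (p ^_) (m+[n∸m]≡n a≤b))

^∣-*-split : ∀ p a {c x y} → p ^ a ∣ x → (∀ d → c ≡ a + d → p ^ d ∣ y) →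
             p ^ c ∣ x * y
^∣-*-split p a {c} {x} {y} p^a∣x rest with c ≤? a
... | yes c≤a = ∣-trans (^-monoʳ-∣ p c≤a) (∣-trans p^a∣x (m∣m*n y))
... | no c≰a = subst (λ n → p ^ n ∣ x * y) a+[c∸a]≡c
  (subst (_∣ x * y) (sym (^-distribˡ-+-* p a (c ∸ a)))
    (*-pres-∣ p^a∣x (rest (c ∸ a) (sym a+[c∸a]≡c))))
  where
  a+[c∸a]≡c : a + (c ∸ a) ≡ c
  a+[c∸a]≡c = m+[n∸m]≡n (≰⇒≥ c≰a)

∣-sum-map : ∀ {d} (f : ℕ → ℕ) xs → (∀ x → d ∣ f x) → d ∣ sum (map f xs)
∣-sum-map f []       d∣f = _ ∣0
∣-sum-map f (x ∷ xs) d∣f = ∣m∣n⇒∣m+n (d∣f x) (∣-sum-map f xs d∣f)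

∣-sumFrom1 : ∀ {d} n f → (∀ i → d ∣ f (suc i)) → d ∣ sumFrom1 n f
∣-sumFrom1 n f = ∣-sum-map (λ i → f (suc i)) (upTo n)

m-zeroˡ : ∀ j → m 0 j ≡ 0
m-zeroˡ zero          = refl
m-zeroˡ (suc zero)    = refl
m-zeroˡ (suc (suc j)) = refl

m-recurrence : ∀ i j → m (suc i) (suc (suc j)) ≡
  25 * m i (suc j) + 25 * m (i ∸ 1) (suc j) + 15 * m (i ∸ 2) (suc j)
  + 5 * m (i ∸ 3) (suc j) + m (i ∸ 4) (suc j)
m-recurrence zero j = refl
m-recurrence 1 j = refl
m-recurrence 2 j = refl
m-recurrence 3 j = refl
m-recurrence 4 j = refl
m-recurrence (suc (suc (suc (suc (suc i))))) j = refl

ColumnBound : ℕ → Set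
ColumnBound j = ∀ i e → 2 * e + i < 5 * j → 5 ^ e ∣ m i j

column-bound₁ : ColumnBound 1
column-bound₁ i zero _ = 1∣ _
column-bound₁ zero (suc e) _ = _ ∣0
column-bound₁ 1 1 _ = ∣-refl
column-bound₁ 2 1 _ = divides 2 refl
column-bound₁ (suc (suc (suc i))) 1 (s≤s (s≤s (s≤s (s≤s (s≤s ())))))
column-bound₁ (suc i) (suc (suc e)) h =
  ⊥-elim (<⇒≱ h (+-mono-≤ (*-monoʳ-≤ 2 (s≤s (s≤s (z≤n {e})))) (s≤s (z≤n {i}))))

column-bound-∸ : ∀ {j e} i t → ColumnBound j → 2 * e + i < 5 * j + t →
                 5 ^ e ∣ m (i ∸ t) j
column-bound-∸ {j} {e} i t bound h with t ≤? i
... | no t≰i rewrite m≤n⇒m∸n≡0 (≰⇒≥ t≰i) | m-zeroˡ j = _ ∣0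
... | yes t≤i = bound (i ∸ t) e (+-cancelʳ-≤ t _ _ (begin
  suc (2 * e + (i ∸ t)) + t ≡⟨ cong suc (+-assoc (2 * e) (i ∸ t) t) ⟩
  suc (2 * e + (i ∸ t + t)) ≡⟨ cong (λ n → suc (2 * e + n)) (m∸n+n≡m t≤i) ⟩
  suc (2 * e + i)           ≤⟨ h ⟩
  5 * j + t                 ∎))
  where open ≤-Reasoning

column-bound-term : ∀ {j i e} t a c → ColumnBound (suc j) → 5 ^ a ∣ c →
  4 ≤ 2 * a + t → 2 * e + suc i < 5 * suc (suc j) →
  5 ^ e ∣ c * m (i ∸ t) (suc j)
column-bound-term {j} {i} {e} t a c bound 5^a∣c 4≤2a+t h =
  ^∣-*-split 5 a {c = e} 5^a∣c λ where
    d refl → column-bound-∸ {suc j} {d} i t bound (+-cancelʳ-≤ 5 _ _ (begin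
      suc (2 * d + i) + 5             ≤⟨ +-monoʳ-≤ (suc (2 * d + i)) (s≤s 4≤2a+t) ⟩
      suc (2 * d + i) + suc (2 * a + t) ≡⟨ regroup a d i t ⟩
      suc (2 * (a + d) + suc i) + t   ≤⟨ +-monoˡ-≤ t h ⟩
      5 * suc (suc j) + t             ≡⟨ regroup-5 j t ⟩
      5 * suc j + t + 5               ∎))
  where
  open ≤-Reasoning
  regroup : ∀ a d i t →
    suc (2 * d + i) + suc (2 * a + t) ≡ suc (2 * (a + d) + suc i) + t
  regroup = solve-∀
  regroup-5 : ∀ j t → 5 * suc (suc j) + t ≡ 5 * suc j + t + 5
  regroup-5 = solve-∀

column-bound-step : ∀ j → ColumnBound (suc j) → ColumnBound (suc (suc j))
column-bound-step j bound zero e _ = _ ∣0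
column-bound-step j bound (suc i) e h =
  subst (5 ^ e ∣_) (sym (m-recurrence i j)) $
  ∣m∣n⇒∣m+n (∣m∣n⇒∣m+n (∣m∣n⇒∣m+n (∣m∣n⇒∣m+n
    (term 0 2 25 ∣-refl ≤-refl)
    (term 1 2 25 ∣-refl (n≤1+n 4)))
    (term 2 1 15 (divides 3 refl) ≤-refl))
    (term 3 1 5 ∣-refl (n≤1+n 4)))
    (subst (5 ^ e ∣_) (*-identityˡ _) (term 4 0 1 ∣-refl ≤-refl))
  where
  term : ∀ t a c → 5 ^ a ∣ c → 4 ≤ 2 * a + t → 5 ^ e ∣ c * m (i ∸ t) (suc j)
  term t a c 5^a∣c 4≤2a+t = column-bound-term {e = e} t a c bound 5^a∣c 4≤2a+t h

m-valuation : ∀ j → ColumnBound j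
m-valuation zero i e ()
m-valuation 1 = column-bound₁
m-valuation (suc (suc j)) = column-bound-step j (m-valuation (suc j))

5^suc∣*5^ : ∀ e c n s → 2 * e ≤ n → suc (n / 2) ≤ s → 5 ^ suc e ∣ c * 5 ^ s
5^suc∣*5^ e c n s 2e≤n n/2<s =
  ∣n⇒∣m*n c (^-monoʳ-∣ 5 (≤-trans (s≤s e≤n/2) n/2<s))
  where
  e≤n/2 : e ≤ n / 2
  e≤n/2 = subst (_≤ n / 2) (m*n/n≡m e 2) (/-monoˡ-≤ 2 (subst (_≤ n) (*-comm 2 e) 2e≤n))

b-valuation : ∀ j k e → 2 * e ≤ 5 * k → 5 ^ (suc j + e) ∣ b (suc j) (suc k)
b-valuation zero 0 zero _ = 5^suc∣*5^ 0 63 0 1 z≤n ≤-refl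
b-valuation zero 1 e h = 5^suc∣*5^ e 52 5 4 h (n≤1+n 3)
b-valuation zero 2 e h = 5^suc∣*5^ e 63 10 6 h ≤-refl
b-valuation zero 3 e h = 5^suc∣*5^ e 6 15 9 h (n≤1+n 8)
b-valuation zero 4 e h = 5^suc∣*5^ e 1 20 11 h ≤-refl
b-valuation zero (suc (suc (suc (suc (suc k))))) e h = _ ∣0
b-valuation (suc j) k e 2e≤5k =
  ∣-sumFrom1 (5 * suc k) (λ i → b (suc j) i * m (6 * i + 6) (suc k + i + 1)) summand
  where
  summand : ∀ i → 5 ^ (suc (suc j) + e) ∣
                  b (suc j) (suc i) * m (6 * suc i + 6) (suc k + suc i + 1)
  summand i = ^∣-*-split 5 (suc j + 2 * i) (b-valuation j i (2 * i) 4i≤5i) rest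
    where
    4i≤5i : 2 * (2 * i) ≤ 5 * i
    4i≤5i = subst (_≤ 5 * i) (*-assoc 2 2 i) (*-monoˡ-≤ i (n≤1+n 4))
    rest : ∀ d → suc (suc j) + e ≡ suc j + 2 * i + d →
           5 ^ d ∣ m (6 * suc i + 6) (suc k + suc i + 1)
    rest d eq = m-valuation (suc k + suc i + 1) (6 * suc i + 6) d (begin
      suc (2 * d + (6 * suc i + 6)) ≡⟨ regroup d i ⟩
      2 * (2 * i + d) + (2 * i + 13) ≡⟨ cong (λ n → 2 * n + (2 * i + 13)) (sym 1+e≡2i+d) ⟩
      2 * suc e + (2 * i + 13)       ≡⟨ regroup′ e i ⟩
      2 * e + (2 * i + 15)           ≤⟨ +-mono-≤ 2e≤5k (+-monoˡ-≤ 15 (*-monoˡ-≤ i (m≤m+n 2 3))) ⟩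
      5 * k + (5 * i + 15)           ≡⟨ regroup″ k i ⟩
      5 * (suc k + suc i + 1)        ∎)
      where
      open ≤-Reasoning
      1+e≡2i+d : suc e ≡ 2 * i + d
      1+e≡2i+d = +-cancelˡ-≡ (suc j) _ _
        (trans (+-suc (suc j) e) (trans eq (+-assoc (suc j) (2 * i) d)))
      regroup : ∀ d i → suc (2 * d + (6 * suc i + 6)) ≡ 2 * (2 * i + d) + (2 * i + 13)
      regroup = solve-∀
      regroup′ : ∀ e i → 2 * suc e + (2 * i + 13) ≡ 2 * e + (2 * i + 15)
      regroup′ = solve-∀
      regroup″ : ∀ k i → 5 * k + (5 * i + 15) ≡ 5 * (suc k + suc i + 1)
      regroup″ = solve-∀

lemma4p5 : (j k : ℕ) → j ≥ 1 → k ≥ 1 →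
    5 ^ (j + (5 * k ∸ 5) / 2) ∣ b j k
lemma4p5 (suc j) (suc k) _ _ = b-valuation j k ((5 * suc k ∸ 5) / 2) (begin
  2 * ((5 * suc k ∸ 5) / 2) ≡⟨ *-comm 2 ((5 * suc k ∸ 5) / 2) ⟩
  (5 * suc k ∸ 5) / 2 * 2   ≤⟨ m/n*n≤m (5 * suc k ∸ 5) 2 ⟩
  5 * suc k ∸ 5             ≡⟨ cong (_∸ 5) (*-suc 5 k) ⟩
  5 + 5 * k ∸ 5             ≡⟨ m+n∸m≡n 5 (5 * k) ⟩
  5 * k                     ∎)
  where open ≤-Reasoning
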